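{- Let $i\ge0$ be an integer. Every disk $D(v,r)$ of an $\alpha_i$-metric graph $G$ is $d^{2i-1}$-convex. In particular, the center $C(G)$ of $G$ is $d^{2i-1}$-convex.
   Context: All graphs are finite, connected, unweighted, undirected, simple; $d(u,v)$ is the shortest-path distance. $I(u,v)=\{x: d(u,x)+d(x,v)=d(u,v)\}$. A graph is $\alpha_i$-metric if for all vertices $u,w,v,x$: whenever $v\in I(u,w)$, $w\in I(v,x)$ and $vw$ is an edge, then $d(u,x)\ge d(u,v)+d(v,x)-i$. $D(v,r)=\{u:d(u,v)\le r\}$. A set $S$ of vertices is $d^k$-convex if for all $x,y\in S$ with $d(x,y)\ge k$, $I(x,y)\subseteq S$. $e(v)=\max_u d(u,v)$, $\operatorname{rad}(G)=\min_v e(v)$, $C(G)=\{v:e(v)=\operatorname{rad}(G)\}$. -}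

module Defs where

open import Data.Nat using (ℕ; zero; suc; _+_; _*_; _∸_; _≤_; _⊔_; _⊓_)
open import Data.Bool using (Bool; true; false; _∨_; _∧_; if_then_else_)
open import Data.Fin using (Fin; _≟_)
open import Data.List using (List; foldr; map)
open import Data.Bool.ListAction using (any)
open import Data.List using (allFin) public
open import Data.Product using (Σ; ∃; _×_)
open import Relation.Nullary.Decidable using (isYes)
open import Relation.Binary.PropositionalEquality using (_≡_)

reach : {n : ℕ} → (Fin n → Fin n → Bool) → ℕ → Fin n → Fin n → Bool
reach adj zero u v = isYes (u ≟ v)
reach {n} adj (suc k) u v =
  reach adj k u v ∨ any (λ w → reach adj k u w ∧ adj w v) (allFin n)

record Graph : Set where
  field
    n         : ℕ
    adj       : Fin n → Fin n → Bool
    adj-sym   : ∀ u v → adj u v ≡ adj v u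
    adj-irr   : ∀ v → adj v v ≡ false
    connected : ∀ u v → ∃ λ k → reach adj k u v ≡ true

module _ (G : Graph) where
  open Graph G

  search : ℕ → ℕ → Fin n → Fin n → ℕ
  search j zero u v = j
  search j (suc fuel) u v = if reach adj j u v then j else search (suc j) fuel u v

  -- shortest-path distance (a shortest walk has length < n, so fuel n suffices)
  dist : Fin n → Fin n → ℕ
  dist u v = search 0 n u v

  Interval : Fin n → Fin n → Fin n → Set
  Interval u v x = dist u x + dist x v ≡ dist u v

  -- α_i-metric:  d(u,x) ≥ d(u,v) + d(v,x) - i   (written without subtraction)
  AlphaMetric : ℕ → Set
  AlphaMetric i = ∀ u w v x → Interval u w v → Interval v x w →
    adj v w ≡ true → dist u v + dist v x ≤ dist u x + i

  Disk : Fin n → ℕ → Fin n → Set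
  Disk v r u = dist v u ≤ r

  DConvex : ℕ → (Fin n → Set) → Set
  DConvex k S = ∀ x y → S x → S y → k ≤ dist x y → ∀ z → Interval x y z → S z

  ecc : Fin n → ℕ
  ecc v = foldr _⊔_ 0 (map (λ u → dist u v) (allFin n))

  -- radius: minimum eccentricity (initial value n exceeds every eccentricity)
  rad : ℕ
  rad = foldr _⊓_ n (map ecc (allFin n))

  Center : Fin n → Set
  Center v = ecc v ≡ rad

-- Let x, y ∈ D(c,r) with d(x,y) ≥ 2i − 1 and suppose some vertex of I(x,y) lies outside
-- the disk. Pick z₀ ∈ I(x,y) farthest from c, at distance m > r. Walking from z₀ back
-- towards x inside I(x,y), the distance to c stays m until it first drops to m − 1 at
-- some w next to a vertex z; there w ∈ I(c,z) and z ∈ I(w,y), so the α_i-metric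
-- inequality bounds m + d(z,y) by d(c,y) + i ≤ r + i. Hence m + d(x,y) ≤ r + i + d(x,z₀),
-- and symmetrically m + d(x,y) ≤ r + i + d(z₀,y). Adding both gives d(x,y) + 2 ≤ 2i,
-- a contradiction. The center is the intersection of the disks D(u, rad G).
module Submission where

open import Defs
open import Data.Nat using (ℕ; zero; suc; _+_; _*_; _∸_; _≤_; _<_; _≟_; _≤?_; s≤s; s≤s⁻¹; z≤n)
open import Data.Nat.Properties
open import Data.Nat.Tactic.RingSolver using (solve-∀)
open import Algebra.Properties.CommutativeSemigroup +-commutativeSemigroup using (x∙yz≈xz∙y)
open import Data.Bool using (T; true; false)
open import Data.Bool.Properties using (T-≡; T-∧; T-∨)
open import Data.Fin using (Fin; toℕ)
open import Data.Fin.Properties using (injective⇒≤; toℕ-injective; toℕ<n)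
open import Data.List using (filter)
open import Data.List.Extrema.Nat using (argmax; argmax-all; f[⊥]≤f[argmax]; f[xs]≤f[argmax])
open import Data.List.Relation.Unary.All using (lookup; tabulate)
open import Data.List.Relation.Unary.All.Properties using (all-filter; map⁺)
open import Data.List.Relation.Unary.Any using (satisfied)
open import Data.List.Relation.Unary.Any.Properties using (any⁺; any⁻)
open import Data.List.Membership.Propositional using (lose)
open import Data.List.Membership.Propositional.Properties using (∈-allFin; ∈-filter⁺; ∈-map⁺)
open import Data.List.Properties using (foldr-preservesᵇ; foldr-preservesᵒ)
open import Data.Product using (∃; _×_; _,_; proj₁; proj₂)
open import Data.Sum using (_⊎_; inj₁; inj₂; [_,_])
open import Function.Bundles using (Equivalence)
open import Relation.Binary.Definitions using (tri<; tri≈; tri>)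
open import Relation.Binary.PropositionalEquality hiding ([_])
open import Relation.Nullary using (¬_; yes; no; contradiction)
open import Relation.Nullary.Decidable using (toWitness; fromWitness; decidable-stable)
open import Relation.Unary using (Pred; Decidable)
open import Function using (_∘_)

open Equivalence using (to; from)

maximiser : ∀ {ℓ n} {P : Pred (Fin n) ℓ} → Decidable P → (f : Fin n → ℕ) → ∀ {a} → P a →
  ∃ λ b → P b × f a ≤ f b × (∀ c → P c → f c ≤ f b)
maximiser {n = n} P? f {a} Pa =
  argmax f a candidates ,
  argmax-all f Pa (all-filter P? (allFin n)) ,
  f[⊥]≤f[argmax] {f = f} a candidates ,
  λ c Pc → lookup (f[xs]≤f[argmax] a candidates) (∈-filter⁺ P? (∈-allFin c) Pc)
  where candidates = filter P? (allFin n)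

short-interval : ∀ {r m i a b L} → r < m → m + L ≤ r + i + a → m + L ≤ r + i + b →
  a + b ≡ L → L < 2 * i ∸ 1
short-interval {r} {m} {i} {a} {b} {L} r<m from-a from-b a+b≡L =
  m+n≤o⇒m≤o∸n (suc L) (+-cancelʳ-≤ (r + r + L) (suc L + 1) (2 * i) (begin
    suc L + 1 + (r + r + L)     ≡⟨ regroupˡ r L ⟩
    (suc r + L) + (suc r + L)   ≤⟨ +-mono-≤ (+-monoˡ-≤ L r<m) (+-monoˡ-≤ L r<m) ⟩
    (m + L) + (m + L)           ≤⟨ +-mono-≤ from-a from-b ⟩
    (r + i + a) + (r + i + b)   ≡⟨ regroupʳ r i a b ⟩
    2 * i + (r + r + (a + b))   ≡⟨ cong (λ t → 2 * i + (r + r + t)) a+b≡L ⟩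
    2 * i + (r + r + L)         ∎))
  where
  open ≤-Reasoning
  regroupˡ : ∀ r L → suc L + 1 + (r + r + L) ≡ (suc r + L) + (suc r + L)
  regroupˡ = solve-∀
  regroupʳ : ∀ r i a b → (r + i + a) + (r + i + b) ≡ 2 * i + (r + r + (a + b))
  regroupʳ = solve-∀

module _ (G : Graph) where
  open Graph G

  -- A record rather than T (reach adj k u v), so that k, u and v are inferable from a proof.
  record Reach (k : ℕ) (u v : Fin n) : Set where
    constructor reached
    field walk : T (reach adj k u v)

  reach-refl : ∀ u → Reach 0 u u
  reach-refl u = reached (fromWitness refl)

  reach-zero⁻ : ∀ {u v} → Reach 0 u v → u ≡ v
  reach-zero⁻ (reached r) = toWitness r

  reach-suc⁺ : ∀ {k u v} → Reach k u v → Reach (suc k) u v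
  reach-suc⁺ (reached r) = reached (from T-∨ (inj₁ r))

  reach-step : ∀ {k u v w} → Reach k u v → adj v w ≡ true → Reach (suc k) u w
  reach-step {v = v} (reached r) e =
    reached (from T-∨ (inj₂ (any⁺ _ (lose (∈-allFin v) (from T-∧ (r , from T-≡ e))))))

  reach-suc⁻ : ∀ {k u v} → Reach (suc k) u v →
    Reach k u v ⊎ ∃ λ w → Reach k u w × adj w v ≡ true
  reach-suc⁻ (reached r) with to T-∨ r
  ... | inj₁ r′ = inj₁ (reached r′)
  ... | inj₂ r′ with satisfied (any⁻ _ (allFin n) r′)
  ...   | w , p = inj₂ (w , reached (proj₁ (to T-∧ p)) , to T-≡ (proj₂ (to T-∧ p)))

  reach-+ : ∀ a b {u v w} → Reach a u v → Reach b v w → Reach (a + b) u w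
  reach-+ a zero r s rewrite +-identityʳ a | reach-zero⁻ s = r
  reach-+ a (suc b) r s rewrite +-suc a b with reach-suc⁻ s
  ... | inj₁ s′           = reach-suc⁺ (reach-+ a b r s′)
  ... | inj₂ (_ , s′ , e) = reach-step (reach-+ a b r s′) e

  reach-sym : ∀ k {u v} → Reach k u v → Reach k v u
  reach-sym zero r rewrite reach-zero⁻ r = reach-refl _
  reach-sym (suc k) r with reach-suc⁻ r
  ... | inj₁ r′ = reach-suc⁺ (reach-sym k r′)
  ... | inj₂ (w , r′ , e) =
    reach-+ 1 k (reach-step (reach-refl _) (trans (adj-sym _ w) e)) (reach-sym k r′)

  IsDistance : ℕ → Fin n → Fin n → Set
  IsDistance j u v = Reach j u v × (∀ {t} → t < j → ¬ Reach t u v)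

  isDistance-unique : ∀ {a b u v} → IsDistance a u v → IsDistance b u v → a ≡ b
  isDistance-unique {a} {b} (ra , min-a) (rb , min-b) with <-cmp a b
  ... | tri< a<b _ _ = contradiction ra (min-b a<b)
  ... | tri≈ _ a≡b _ = a≡b
  ... | tri> _ _ b<a = contradiction rb (min-a b<a)

  search-isDistance : ∀ fuel {j k u v} → j ≤ k → k < j + fuel → Reach k u v →
    (∀ {t} → t < j → ¬ Reach t u v) → IsDistance (search G j fuel u v) u v
  search-isDistance zero {j} j≤k k<j+0 r _ =
    contradiction (subst (j <_) (+-identityʳ j) (≤-<-trans j≤k k<j+0)) (n≮n j)
  search-isDistance (suc fuel) {j} {k} {u} {v} j≤k k<j+fuel r below with reach adj j u v in eq
  ... | true  = reached (from T-≡ eq) , below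
  ... | false =
    search-isDistance fuel (≤∧≢⇒< j≤k j≢k) (subst (k <_) (+-suc j fuel) k<j+fuel) r below′
    where
    j≢k : j ≢ k
    j≢k refl = subst T eq (Reach.walk r)
    below′ : ∀ {t} → t < suc j → ¬ Reach t u v
    below′ t<1+j with m≤n⇒m<n∨m≡n (s≤s⁻¹ t<1+j)
    ... | inj₁ t<j  = below t<j
    ... | inj₂ refl = subst T eq ∘ Reach.walk

  isDistance-pred : ∀ {j u v} → IsDistance (suc j) u v → ∃ λ w → IsDistance j u w × adj w v ≡ true
  isDistance-pred {j} (r , minimal) with reach-suc⁻ r
  ... | inj₁ r′ = contradiction r′ (minimal ≤-refl)
  ... | inj₂ (w , r′ , e) = w , (r′ , λ t<j r″ → minimal (s≤s t<j) (reach-step r″ e)) , e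

  isDistance-≤ : ∀ {D u v} → IsDistance D u v → ∀ {j} → j ≤ D → ∃ λ w → IsDistance j u w
  isDistance-≤ {zero} {v = v} d z≤n = v , d
  isDistance-≤ {suc D} {v = v} d j≤1+D with m≤n⇒m<n∨m≡n j≤1+D
  ... | inj₂ refl = v , d
  ... | inj₁ j<1+D = isDistance-≤ (proj₁ (proj₂ (isDistance-pred d))) (s≤s⁻¹ j<1+D)

  -- The vertices at distances 0, 1, …, D from u are pairwise distinct.
  isDistance<n : ∀ {D u v} → IsDistance D u v → D < n
  isDistance<n {D} {u} d = injective⇒≤ {f = vertex-at} λ {a} {b} eq →
    toℕ-injective (isDistance-unique (subst (IsDistance _ u) eq (proj₂ (at a))) (proj₂ (at b)))
    where
    at : ∀ k → ∃ λ w → IsDistance (toℕ k) u w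
    at k = isDistance-≤ d (s≤s⁻¹ (toℕ<n k))
    vertex-at : Fin (suc D) → Fin n
    vertex-at k = proj₁ (at k)

  dist-isDistance : ∀ u v → IsDistance (dist G u v) u v
  dist-isDistance u v with connected u v
  ... | k , r = search-isDistance n z≤n (isDistance<n d) (proj₁ d) (λ ())
    where
    d : IsDistance (search G 0 (suc k) u v) u v
    d = search-isDistance (suc k) z≤n ≤-refl (reached (from T-≡ r)) (λ ())

  reach⇒dist≤ : ∀ {k u v} → Reach k u v → dist G u v ≤ k
  reach⇒dist≤ {k} {u} {v} r with dist G u v ≤? k
  ... | yes d≤k = d≤k
  ... | no d≰k = contradiction r (proj₂ (dist-isDistance u v) (≰⇒> d≰k))

  dist-reach : ∀ u v → Reach (dist G u v) u v
  dist-reach u v = proj₁ (dist-isDistance u v)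

  dist-triangle : ∀ u v w → dist G u w ≤ dist G u v + dist G v w
  dist-triangle u v w = reach⇒dist≤ (reach-+ _ _ (dist-reach u v) (dist-reach v w))

  dist-sym : ∀ u v → dist G u v ≡ dist G v u
  dist-sym u v = ≤-antisym (reach⇒dist≤ (reach-sym _ (dist-reach v u)))
                           (reach⇒dist≤ (reach-sym _ (dist-reach u v)))

  dist≡0⇒≡ : ∀ {u v} → dist G u v ≡ 0 → u ≡ v
  dist≡0⇒≡ {u} {v} d≡0 = reach-zero⁻ (subst (λ k → Reach k u v) d≡0 (dist-reach u v))

  adj⇒dist≡1 : ∀ {u v} → adj u v ≡ true → dist G u v ≡ 1
  adj⇒dist≡1 {u} {v} e = ≤-antisym (reach⇒dist≤ (reach-step (reach-refl u) e)) (n≢0⇒n>0 d≢0)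
    where
    d≢0 : dist G u v ≢ 0
    d≢0 d≡0 with dist≡0⇒≡ d≡0
    ... | refl = contradiction (trans (sym e) (adj-irr u)) λ ()

  dist-pred : ∀ {k u v} → dist G u v ≡ suc k → ∃ λ w → adj w v ≡ true × dist G u w ≡ k
  dist-pred {k} {u} {v} d≡1+k
    with isDistance-pred (subst (λ j → IsDistance j u v) d≡1+k (dist-isDistance u v))
  ... | w , d , e = w , e , isDistance-unique (dist-isDistance u w) d

  interval? : ∀ x y → Decidable (Interval G x y)
  interval? x y z = dist G x z + dist G z y ≟ dist G x y

  interval-sym : ∀ {x y z} → Interval G x y z → Interval G y x z
  interval-sym {x} {y} {z} z∈I = begin
    dist G y z + dist G z x  ≡⟨ cong₂ _+_ (dist-sym y z) (dist-sym z x) ⟩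
    dist G z y + dist G x z  ≡⟨ +-comm (dist G z y) (dist G x z) ⟩
    dist G x z + dist G z y  ≡⟨ z∈I ⟩
    dist G x y               ≡⟨ dist-sym x y ⟩
    dist G y x               ∎
    where open ≡-Reasoning

  interval-neighbour : ∀ {x y z w k} → Interval G x y z → dist G x z ≡ suc k →
    adj w z ≡ true → dist G x w ≡ k → Interval G x y w × Interval G w y z
  interval-neighbour {x} {y} {z} {w} {k} z∈I xz≡1+k e xw≡k = w∈I , z∈I′
    where
    wz≡1 : dist G w z ≡ 1
    wz≡1 = adj⇒dist≡1 e
    wy≤ : dist G w y ≤ suc (dist G z y)
    wy≤ = ≤-trans (dist-triangle w z y) (≤-reflexive (cong (_+ dist G z y) wz≡1))
    wy≥ : suc (dist G z y) ≤ dist G w y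
    wy≥ = +-cancelˡ-≤ k (suc (dist G z y)) (dist G w y) (begin
      k + suc (dist G z y)       ≡⟨ +-suc k (dist G z y) ⟩
      suc k + dist G z y         ≡⟨ cong (_+ dist G z y) (sym xz≡1+k) ⟩
      dist G x z + dist G z y    ≡⟨ z∈I ⟩
      dist G x y                 ≤⟨ dist-triangle x w y ⟩
      dist G x w + dist G w y    ≡⟨ cong (_+ dist G w y) xw≡k ⟩
      k + dist G w y             ∎)
      where open ≤-Reasoning
    wy≡ : dist G w y ≡ suc (dist G z y)
    wy≡ = ≤-antisym wy≤ wy≥
    w∈I : Interval G x y w
    w∈I = trans (cong₂ _+_ xw≡k wy≡)
                (trans (+-suc k (dist G z y)) (trans (cong (_+ dist G z y) (sym xz≡1+k)) z∈I))
    z∈I′ : Interval G w y z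
    z∈I′ = trans (cong (_+ dist G z y) wz≡1) (sym wy≡)

  dist≤ecc : ∀ u v → dist G u v ≤ ecc G v
  dist≤ecc u v =
    foldr-preservesᵒ {P = dist G u v ≤_} (λ a b → [ m≤n⇒m≤n⊔o b , m≤n⇒m≤o⊔n a ]) 0 _
    (inj₂ (lose (∈-map⁺ (λ w → dist G w v) (∈-allFin u)) ≤-refl))

  ecc≤ : ∀ {v b} → (∀ u → dist G u v ≤ b) → ecc G v ≤ b
  ecc≤ {v} {b} bound = foldr-preservesᵇ {P = _≤ b} ⊔-lub z≤n
    (map⁺ {f = λ u → dist G u v} (tabulate {xs = allFin n} λ {u} _ → bound u))

  rad≤ecc : ∀ v → rad G ≤ ecc G v
  rad≤ecc v =
    foldr-preservesᵒ {P = _≤ ecc G v} (λ a b → [ m≤n⇒m⊓o≤n b , m≤n⇒o⊓m≤n a ]) n _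
    (inj₂ (lose (∈-map⁺ (ecc G) (∈-allFin v)) ≤-refl))

  module _ {i} (α : AlphaMetric G i) where

    alpha-edge-bound : ∀ {c z w y} → Interval G c z w → Interval G w y z → adj w z ≡ true →
      dist G c z + dist G z y ≤ dist G c y + i
    alpha-edge-bound {c} {z} {w} {y} w∈I z∈I e = begin
      dist G c z + dist G z y                  ≡⟨ cong (_+ dist G z y) (sym w∈I) ⟩
      dist G c w + dist G w z + dist G z y     ≡⟨ +-assoc (dist G c w) (dist G w z) (dist G z y) ⟩
      dist G c w + (dist G w z + dist G z y)   ≡⟨ cong (dist G c w +_) z∈I ⟩
      dist G c w + dist G w y                  ≤⟨ α c z w y w∈I z∈I e ⟩
      dist G c y + i                           ∎
      where open ≤-Reasoning

    module _ {c x y m} (x-inside : dist G c x < m)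
             (m-max : ∀ w → Interval G x y w → dist G c w ≤ m) where

      peak-drop-bound : ∀ {k z w} → Interval G x y z → dist G c z ≡ m → dist G x z ≡ suc k →
        adj w z ≡ true → Interval G w y z → dist G c w < m →
        m + dist G x y ≤ dist G c y + i + suc k
      peak-drop-bound {k} {z} {w} z∈I cz≡m xz≡1+k e z∈I′ cw<m = begin
        m + dist G x y
          ≡⟨ cong₂ _+_ (sym cz≡m) (sym z∈I) ⟩
        dist G c z + (dist G x z + dist G z y)
          ≡⟨ cong (λ t → dist G c z + (t + dist G z y)) xz≡1+k ⟩
        dist G c z + (suc k + dist G z y)
          ≡⟨ x∙yz≈xz∙y (dist G c z) (suc k) (dist G z y) ⟩
        dist G c z + dist G z y + suc k
          ≤⟨ +-monoˡ-≤ (suc k) (alpha-edge-bound w∈I z∈I′ e) ⟩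
        dist G c y + i + suc k
          ∎
        where
        open ≤-Reasoning
        w∈I : Interval G c z w
        w∈I = ≤-antisym (begin
          dist G c w + dist G w z  ≡⟨ cong (dist G c w +_) (adj⇒dist≡1 e) ⟩
          dist G c w + 1           ≡⟨ +-comm (dist G c w) 1 ⟩
          suc (dist G c w)         ≤⟨ cw<m ⟩
          m                        ≡⟨ cz≡m ⟨
          dist G c z               ∎) (dist-triangle c w z)

      peak-bound : ∀ k {z} → Interval G x y z → dist G c z ≡ m → dist G x z ≡ k →
        m + dist G x y ≤ dist G c y + i + k
      peak-bound zero z∈I cz≡m xz≡0 =
        contradiction (subst (λ t → dist G c t ≡ m) (sym (dist≡0⇒≡ xz≡0)) cz≡m) (<⇒≢ x-inside)
      peak-bound (suc k) z∈I cz≡m xz≡1+k =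
        let w , e , xw≡k = dist-pred xz≡1+k
            w∈I , z∈I′ = interval-neighbour z∈I xz≡1+k e xw≡k
        in [ peak-drop-bound z∈I cz≡m xz≡1+k e z∈I′
           , (λ cw≡m → ≤-trans (peak-bound k w∈I cw≡m xw≡k) (+-monoʳ-≤ (dist G c y + i) (n≤1+n k)))
           ] (m≤n⇒m<n∨m≡n (m-max w w∈I))

    far-interval-short : ∀ {c r x y z₀} → dist G c x ≤ r → dist G c y ≤ r → Interval G x y z₀ →
      r < dist G c z₀ → (∀ w → Interval G x y w → dist G c w ≤ dist G c z₀) →
      dist G x y < 2 * i ∸ 1
    far-interval-short {c} {r} {x} {y} {z₀} x∈D y∈D z₀∈I r<m z₀-max =
      short-interval r<m via-x via-y z₀∈I
      where
      via-x : dist G c z₀ + dist G x y ≤ r + i + dist G x z₀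
      via-x = ≤-trans
        (peak-bound {c} {x} {y} (≤-<-trans x∈D r<m) z₀-max (dist G x z₀) z₀∈I refl refl)
        (+-monoˡ-≤ (dist G x z₀) (+-monoˡ-≤ i y∈D))
      via-y : dist G c z₀ + dist G x y ≤ r + i + dist G z₀ y
      via-y = subst₂ (λ a b → dist G c z₀ + a ≤ r + i + b) (dist-sym y x) (dist-sym y z₀)
        (≤-trans (peak-bound {c} {y} {x} (≤-<-trans y∈D r<m) (λ w → z₀-max w ∘ interval-sym)
                   (dist G y z₀) (interval-sym z₀∈I) refl refl)
                 (+-monoˡ-≤ (dist G y z₀) (+-monoˡ-≤ i x∈D)))

    disk-convex : ∀ c r → DConvex G (2 * i ∸ 1) (Disk G c r)
    disk-convex c r x y x∈D y∈D L≥ z z∈I = decidable-stable (dist G c z ≤? r) λ z∉D →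
      let z₀ , z₀∈I , cz≤cz₀ , z₀-max = maximiser (interval? x y) (dist G c) z∈I
      in <⇒≱ (far-interval-short x∈D y∈D z₀∈I (<-≤-trans (≰⇒> z∉D) cz≤cz₀) z₀-max) L≥

    center-convex : DConvex G (2 * i ∸ 1) (Center G)
    center-convex x y x∈C y∈C L≥ z z∈I = ≤-antisym
      (ecc≤ λ u → disk-convex u (rad G) x y (within-rad x∈C u) (within-rad y∈C u) L≥ z z∈I)
      (rad≤ecc z)
      where
      within-rad : ∀ {v} → Center G v → ∀ u → dist G u v ≤ rad G
      within-rad v∈C u = ≤-trans (dist≤ecc u _) (≤-reflexive v∈C)

lemma3 : (i : ℕ) (G : Graph) → AlphaMetric G i →
    ((v : Fin (Graph.n G)) (r : ℕ) → DConvex G (2 * i ∸ 1) (Disk G v r))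
    × DConvex G (2 * i ∸ 1) (Center G)
lemma3 i G α = disk-convex G α , center-convex G α
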